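{- Let $m$ be a positive integer. Every positive integer solution $n$ of \[\sigma_2(n)-n^2=L_{2m}\,n-(L_{2m}^2-5)\] with $n>(L_{2m}+L_{2m}^2-5)^3$ is of one of the following forms: (i) $n=L_{2k}L_{2k+2m}$ for some integer $k\ge 0$, where both $L_{2k}$ and $L_{2k+2m}$ are primes; (ii) $n=L_{2k}L_{2m-2k}$ for some integer $k$ with $0\le k\le m$ and $k\neq \frac{m}{2}$, where both $L_{2k}$ and $L_{2m-2k}$ are primes.
   Context: $\sigma_2(n)=\sum_{d\mid n}d^2$. $L_n$ are the Lucas numbers: $L_0=2$, $L_1=1$, $L_n=L_{n-1}+L_{n-2}$. A Lucas prime is a Lucas number that is prime. -}

module Defs where

open import Data.Nat using (ℕ; zero; suc; _+_; _*_; _^_)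
open import Data.Nat.Divisibility using (_∣?_)
open import Data.List using (List; upTo; filter; map)
open import Data.Nat.ListAction using (sum)

L : ℕ → ℕ
L zero = 2
L (suc zero) = 1
L (suc (suc n)) = L (suc n) + L n

-- divisors of n (for n ≥ 1): all d ∈ {0,…,n} with d ∣ n
-- (0 ∣ n only when n = 0, so for n ≥ 1 these are exactly the positive divisors)
divisors : ℕ → List ℕ
divisors n = filter (λ d → d ∣? n) (upTo (suc n))

σ₂ : ℕ → ℕ
σ₂ n = sum (map (λ d → d ^ 2) (divisors n))

module Submission where

-- Let l = L₂ₘ ≥ 3 and let n > (l + l² - 5)³ ≥ l³ solve σ₂(n) + l² = n² + l n + 5.
-- A prime n would satisfy l² = l n + 4, forcing n < l.  For any proper divisor
-- d of n, σ₂(n) ≥ 1 + d² + n² gives d² < l n; hence n has no factorisation into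
-- three factors > 1 (it would give n < l³), and n is not a prime square.  So
-- n = p q with distinct primes and p² + q² + l² = l p q + 4.  As a quadratic in
-- q its discriminant is (l² - 4)(p² - 4) = 5F₂ₘ²(p² - 4), so p² = 5u² + 4 and,
-- by descent on the units of t² + tv - v², p = L₂ₖ.  The two roots q are then
-- L₂ₖ₊₂ₘ and L₂|ₘ₋ₖ|, by the addition and product formulas for Lucas numbers.

open import Defs

module EvenLucas where

  open import Data.Nat as ℕ using (ℕ; zero; suc)
  open import Data.Integer using (ℤ; +_; _+_; _*_; _-_)
  import Data.Integer.Properties as ℤP
  import Data.Nat.Properties as ℕP
  open import Data.Integer.Tactic.RingSolver using (solve-∀)
  import Data.Nat.Tactic.RingSolver as ℕSolver
  open import Relation.Binary.PropositionalEquality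
  open ≡-Reasoning

  Λ : ℕ → ℤ
  Λ j = + L (2 ℕ.* j)

  L-skip : ∀ n → L (4 ℕ.+ n) ℕ.+ L n ≡ 3 ℕ.* L (2 ℕ.+ n)
  L-skip n = identity (L n) (L (1 ℕ.+ n))
    where
    identity : ∀ a b → ((b ℕ.+ a) ℕ.+ b) ℕ.+ (b ℕ.+ a) ℕ.+ a ≡ 3 ℕ.* (b ℕ.+ a)
    identity = ℕSolver.solve-∀

  move-right : ∀ {a b c} → a + b ≡ c → a ≡ c - b
  move-right {a} {b} refl = identity a b
    where
    identity : ∀ a b → a ≡ (a + b) - b
    identity = solve-∀

  Λ-rec : ∀ j → Λ (2 ℕ.+ j) ≡ + 3 * Λ (1 ℕ.+ j) - Λ j
  Λ-rec j = move-right skip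
    where
    index : ∀ j → 2 ℕ.* (2 ℕ.+ j) ≡ 4 ℕ.+ 2 ℕ.* j
    index = ℕSolver.solve-∀
    index′ : ∀ j → 2 ℕ.* (1 ℕ.+ j) ≡ 2 ℕ.+ 2 ℕ.* j
    index′ = ℕSolver.solve-∀
    skip : Λ (2 ℕ.+ j) + Λ j ≡ + 3 * Λ (1 ℕ.+ j)
    skip = begin
      + L (2 ℕ.* (2 ℕ.+ j)) + + L (2 ℕ.* j)      ≡⟨ cong (λ i → + L i + Λ j) (index j) ⟩
      + L (4 ℕ.+ 2 ℕ.* j) + + L (2 ℕ.* j)        ≡⟨ ℤP.pos-+ (L (4 ℕ.+ 2 ℕ.* j)) (L (2 ℕ.* j)) ⟨
      + (L (4 ℕ.+ 2 ℕ.* j) ℕ.+ L (2 ℕ.* j))      ≡⟨ cong +_ (L-skip (2 ℕ.* j)) ⟩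
      + (3 ℕ.* L (2 ℕ.+ 2 ℕ.* j))                ≡⟨ ℤP.pos-* 3 (L (2 ℕ.+ 2 ℕ.* j)) ⟩
      + 3 * + L (2 ℕ.+ 2 ℕ.* j)                  ≡⟨ cong (λ i → + 3 * + L i) (index′ j) ⟨
      + 3 * Λ (1 ℕ.+ j)                          ∎

  Λ-rec-back : ∀ j → Λ j ≡ + 3 * Λ (1 ℕ.+ j) - Λ (2 ℕ.+ j)
  Λ-rec-back j = begin
      Λ j                                                  ≡⟨ identity (Λ j) (Λ (1 ℕ.+ j)) ⟩
      + 3 * Λ (1 ℕ.+ j) - (+ 3 * Λ (1 ℕ.+ j) - Λ j)        ≡⟨ cong (λ t → + 3 * Λ (1 ℕ.+ j) - t) (Λ-rec j) ⟨
      + 3 * Λ (1 ℕ.+ j) - Λ (2 ℕ.+ j)                      ∎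
    where
    identity : ∀ a b → a ≡ + 3 * b - (+ 3 * b - a)
    identity = solve-∀

  -- The algebraic core of the induction step for Λ-sum: applying the
  -- recurrence operator u ↦ 3u₁ - u₀ termwise to two equations p + a = x·u.
  sum-step : ∀ p₁ p₀ a₁ a₂ x u v → p₁ + a₁ ≡ x * u → p₀ + a₂ ≡ x * v →
             (+ 3 * p₁ - p₀) + (+ 3 * a₁ - a₂) ≡ x * (+ 3 * u - v)
  sum-step p₁ p₀ a₁ a₂ x u v h₁ h₀ = begin
      (+ 3 * p₁ - p₀) + (+ 3 * a₁ - a₂)    ≡⟨ regroup p₁ p₀ a₁ a₂ ⟩
      + 3 * (p₁ + a₁) - (p₀ + a₂)          ≡⟨ cong₂ (λ s t → + 3 * s - t) h₁ h₀ ⟩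
      + 3 * (x * u) - x * v                ≡⟨ factor x u v ⟩
      x * (+ 3 * u - v)                    ∎
    where
    regroup : ∀ p₁ p₀ a₁ a₂ → (+ 3 * p₁ - p₀) + (+ 3 * a₁ - a₂) ≡ + 3 * (p₁ + a₁) - (p₀ + a₂)
    regroup = solve-∀
    factor : ∀ x u v → + 3 * (x * u) - x * v ≡ x * (+ 3 * u - v)
    factor = solve-∀

  Λ-sum-step : ∀ j a →
    Λ (1 ℕ.+ a ℕ.+ 2 ℕ.* (1 ℕ.+ j)) + Λ (1 ℕ.+ a) ≡ Λ (1 ℕ.+ a ℕ.+ (1 ℕ.+ j)) * Λ (1 ℕ.+ j) →
    Λ (2 ℕ.+ a ℕ.+ 2 ℕ.* j) + Λ (2 ℕ.+ a) ≡ Λ (2 ℕ.+ a ℕ.+ j) * Λ j →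
    Λ (a ℕ.+ 2 ℕ.* (2 ℕ.+ j)) + Λ a ≡ Λ (a ℕ.+ (2 ℕ.+ j)) * Λ (2 ℕ.+ j)
  Λ-sum-step j a ih₁ ih₀ = begin
      Λ (a ℕ.+ 2 ℕ.* (2 ℕ.+ j)) + Λ a
        ≡⟨ cong₂ _+_ (cong Λ (shift₁ a j)) (Λ-rec-back a) ⟩
      Λ (2 ℕ.+ N) + (+ 3 * Λ (1 ℕ.+ a) - Λ (2 ℕ.+ a))
        ≡⟨ cong (_+ (+ 3 * Λ (1 ℕ.+ a) - Λ (2 ℕ.+ a))) (Λ-rec N) ⟩
      (+ 3 * Λ (1 ℕ.+ N) - Λ N) + (+ 3 * Λ (1 ℕ.+ a) - Λ (2 ℕ.+ a))
        ≡⟨ sum-step (Λ (1 ℕ.+ N)) (Λ N) (Λ (1 ℕ.+ a)) (Λ (2 ℕ.+ a))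
                    (Λ (2 ℕ.+ a ℕ.+ j)) (Λ (1 ℕ.+ j)) (Λ j) ih₁′ ih₀ ⟩
      Λ (2 ℕ.+ a ℕ.+ j) * (+ 3 * Λ (1 ℕ.+ j) - Λ j)
        ≡⟨ cong₂ _*_ (cong Λ (shift₂ a j)) (Λ-rec j) ⟨
      Λ (a ℕ.+ (2 ℕ.+ j)) * Λ (2 ℕ.+ j)
        ∎
    where
    N = 2 ℕ.+ a ℕ.+ 2 ℕ.* j
    shift₁ : ∀ a j → a ℕ.+ 2 ℕ.* (2 ℕ.+ j) ≡ 2 ℕ.+ (2 ℕ.+ a ℕ.+ 2 ℕ.* j)
    shift₁ = ℕSolver.solve-∀
    shift₂ : ∀ a j → a ℕ.+ (2 ℕ.+ j) ≡ 2 ℕ.+ a ℕ.+ j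
    shift₂ = ℕSolver.solve-∀
    shift₃ : ∀ a j → 1 ℕ.+ a ℕ.+ 2 ℕ.* (1 ℕ.+ j) ≡ 1 ℕ.+ (2 ℕ.+ a ℕ.+ 2 ℕ.* j)
    shift₃ = ℕSolver.solve-∀
    shift₄ : ∀ a j → 1 ℕ.+ a ℕ.+ (1 ℕ.+ j) ≡ 2 ℕ.+ a ℕ.+ j
    shift₄ = ℕSolver.solve-∀
    ih₁′ : Λ (1 ℕ.+ N) + Λ (1 ℕ.+ a) ≡ Λ (2 ℕ.+ a ℕ.+ j) * Λ (1 ℕ.+ j)
    ih₁′ = subst₂ (λ s t → Λ s + Λ (1 ℕ.+ a) ≡ Λ t * Λ (1 ℕ.+ j)) (shift₃ a j) (shift₄ a j) ih₁

  Λ-sum : ∀ j a → Λ (a ℕ.+ 2 ℕ.* j) + Λ a ≡ Λ (a ℕ.+ j) * Λ j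
  Λ-sum zero a = subst (λ i → Λ i + Λ a ≡ Λ i * + 2) (sym (ℕP.+-identityʳ a)) (identity (Λ a))
    where
    identity : ∀ x → x + x ≡ x * + 2
    identity = solve-∀
  Λ-sum (suc zero) a = begin
      Λ (a ℕ.+ 2) + Λ a                          ≡⟨ cong (λ i → Λ i + Λ a) (ℕP.+-comm a 2) ⟩
      Λ (2 ℕ.+ a) + Λ a                          ≡⟨ cong (_+ Λ a) (Λ-rec a) ⟩
      (+ 3 * Λ (1 ℕ.+ a) - Λ a) + Λ a            ≡⟨ identity (Λ (1 ℕ.+ a)) (Λ a) ⟩
      Λ (1 ℕ.+ a) * + 3                          ≡⟨ cong (λ i → Λ i * + 3) (ℕP.+-comm 1 a) ⟩
      Λ (a ℕ.+ 1) * + 3                          ∎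
    where
    identity : ∀ x y → (+ 3 * x - y) + y ≡ x * + 3
    identity = solve-∀
  Λ-sum (suc (suc j)) a = Λ-sum-step j a (Λ-sum (suc j) (suc a)) (Λ-sum j (2 ℕ.+ a))

  Λ-double : ∀ j → Λ (2 ℕ.* j) + + 2 ≡ Λ j * Λ j
  Λ-double j = Λ-sum j 0

  Λ-product : ∀ j a → Λ (a ℕ.+ 2 ℕ.* j) * Λ a ≡ Λ (a ℕ.+ j) * Λ (a ℕ.+ j) + Λ j * Λ j - + 4
  Λ-product j a = begin
      Λ (a ℕ.+ 2 ℕ.* j) * Λ a
        ≡⟨ cong (λ i → Λ i * Λ a) (ℕP.+-comm a (2 ℕ.* j)) ⟩
      Λ (2 ℕ.* j ℕ.+ a) * Λ a
        ≡⟨ Λ-sum a (2 ℕ.* j) ⟨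
      Λ (2 ℕ.* j ℕ.+ 2 ℕ.* a) + Λ (2 ℕ.* j)
        ≡⟨ cong (λ i → Λ i + Λ (2 ℕ.* j)) (ℕP.*-distribˡ-+ 2 j a) ⟨
      Λ (2 ℕ.* (j ℕ.+ a)) + Λ (2 ℕ.* j)
        ≡⟨ cong₂ _+_ (move-right {Λ (2 ℕ.* (j ℕ.+ a))} (Λ-double (j ℕ.+ a)))
                     (move-right {Λ (2 ℕ.* j)} (Λ-double j)) ⟩
      (Λ (j ℕ.+ a) * Λ (j ℕ.+ a) - + 2) + (Λ j * Λ j - + 2)
        ≡⟨ cong (λ i → (Λ i * Λ i - + 2) + (Λ j * Λ j - + 2)) (ℕP.+-comm j a) ⟩
      (Λ (a ℕ.+ j) * Λ (a ℕ.+ j) - + 2) + (Λ j * Λ j - + 2)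
        ≡⟨ identity (Λ (a ℕ.+ j) * Λ (a ℕ.+ j)) (Λ j * Λ j) ⟩
      Λ (a ℕ.+ j) * Λ (a ℕ.+ j) + Λ j * Λ j - + 4
        ∎
    where
    identity : ∀ u v → (u - + 2) + (v - + 2) ≡ u + v - + 4
    identity = solve-∀

module Vieta where

  open EvenLucas
  open import Data.Nat as ℕ using (ℕ; _≤_; _∸_)
  import Data.Nat.Properties as ℕP
  open import Data.Integer using (ℤ; +_; _+_; _*_; _-_)
  import Data.Integer.Properties as ℤP
  open import Data.Integer.Tactic.RingSolver using (solve-∀)
  open import Data.Product using (_×_; _,_)
  open import Data.Sum using (_⊎_; inj₁; inj₂)
  import Data.Sum
  open import Relation.Binary.PropositionalEquality
  open ≡-Reasoning

  quadratic-roots : ∀ {y y₁ y₂ s p} → y₁ + y₂ ≡ s → y₁ * y₂ ≡ p →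
                    y * y - s * y + p ≡ + 0 → y ≡ y₁ ⊎ y ≡ y₂
  quadratic-roots {y} {y₁} {y₂} refl refl root
    with ℤP.i*j≡0⇒i≡0∨j≡0 (y - y₁) (trans (factorise y y₁ y₂) root)
    where
    factorise : ∀ y y₁ y₂ → (y - y₁) * (y - y₂) ≡ y * y - (y₁ + y₂) * y + y₁ * y₂
    factorise = solve-∀
  ... | inj₁ y-y₁≡0 = inj₁ (ℤP.i-j≡0⇒i≡j y y₁ y-y₁≡0)
  ... | inj₂ y-y₂≡0 = inj₂ (ℤP.i-j≡0⇒i≡j y y₂ y-y₂≡0)

  Lucas-equation : ℤ → ℤ → ℤ → Set
  Lucas-equation x c y = x * x + y * y + c * c ≡ c * x * y + + 4

  Lucas-equation-sym : ∀ x c y → Lucas-equation x c y → Lucas-equation c x y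
  Lucas-equation-sym x c y eq = begin
      c * c + y * y + x * x    ≡⟨ swap x c y ⟩
      x * x + y * y + c * c    ≡⟨ eq ⟩
      c * x * y + + 4          ≡⟨ cong (λ t → t * y + + 4) (ℤP.*-comm c x) ⟩
      x * c * y + + 4          ∎
    where
    swap : ∀ x c y → c * c + y * y + x * x ≡ x * x + y * y + c * c
    swap = solve-∀

  Λ-roots : ∀ a j y → Lucas-equation (Λ (a ℕ.+ j)) (Λ j) y → y ≡ Λ (a ℕ.+ 2 ℕ.* j) ⊎ y ≡ Λ a
  Λ-roots a j y eq = quadratic-roots (Λ-sum j a) (Λ-product j a) root
    where
    X = Λ (a ℕ.+ j)
    C = Λ j
    rearrange : ∀ X C y → y * y - (X * C) * y + (X * X + C * C - + 4)
                          ≡ (X * X + y * y + C * C) - (C * X * y + + 4)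
    rearrange = solve-∀
    root : y * y - (X * C) * y + (X * X + C * C - + 4) ≡ + 0
    root = begin
      y * y - (X * C) * y + (X * X + C * C - + 4)    ≡⟨ rearrange X C y ⟩
      (X * X + y * y + C * C) - (C * X * y + + 4)    ≡⟨ ℤP.i≡j⇒i-j≡0 eq ⟩
      + 0                                            ∎

  ∸-plus-double : ∀ {m n} → n ≤ m → m ∸ n ℕ.+ 2 ℕ.* n ≡ m ℕ.+ n
  ∸-plus-double {m} {n} n≤m = begin
      m ∸ n ℕ.+ 2 ℕ.* n          ≡⟨ cong (λ t → m ∸ n ℕ.+ (n ℕ.+ t)) (ℕP.+-identityʳ n) ⟩
      m ∸ n ℕ.+ (n ℕ.+ n)        ≡⟨ ℕP.+-assoc (m ∸ n) n n ⟨
      m ∸ n ℕ.+ n ℕ.+ n          ≡⟨ cong (ℕ._+ n) (ℕP.m∸n+n≡m n≤m) ⟩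
      m ℕ.+ n                    ∎

  Λ-solutions : ∀ k m y → Lucas-equation (Λ k) (Λ m) y →
    y ≡ Λ (k ℕ.+ m) ⊎ (k ≤ m × y ≡ Λ (m ∸ k)) ⊎ (m ≤ k × y ≡ Λ (k ∸ m))
  Λ-solutions k m y eq with ℕP.≤-total k m
  ... | inj₁ k≤m = Data.Sum.map (λ y≡ → trans y≡ (cong Λ (trans (∸-plus-double k≤m) (ℕP.+-comm m k))))
                                (λ y≡ → inj₁ (k≤m , y≡))
                                (Λ-roots (m ∸ k) k y eq′)
    where
    eq′ : Lucas-equation (Λ (m ∸ k ℕ.+ k)) (Λ k) y
    eq′ = subst (λ i → Lucas-equation (Λ i) (Λ k) y) (sym (ℕP.m∸n+n≡m k≤m))
                (Lucas-equation-sym (Λ k) (Λ m) y eq)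
  ... | inj₂ m≤k = Data.Sum.map (λ y≡ → trans y≡ (cong Λ (∸-plus-double m≤k)))
                                (λ y≡ → inj₂ (m≤k , y≡))
                                (Λ-roots (k ∸ m) m y eq′)
    where
    eq′ : Lucas-equation (Λ (k ∸ m ℕ.+ m)) (Λ m) y
    eq′ = subst (λ i → Lucas-equation (Λ i) (Λ m) y) (sym (ℕP.m∸n+n≡m m≤k)) eq

-- The Pell-type equation x² = 5u² + 4 is solved exactly by x = L₂ₖ, via the
-- units of the norm form t² + tv - v².
module Pell where

  open import Data.Nat as ℕ using (ℕ; zero; suc; _+_; _*_; _∸_; _≤_; _<_; _≤?_; z≤n; s≤s; z<s)
  open import Data.Nat.Properties
  open import Data.Nat.Divisibility using (_∣_; divides; ∣m+n∣m⇒∣n)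
  open import Data.Nat.Induction using (<-rec)
  open import Data.Nat.Primality using (Prime; euclidsLemma; prime[2])
  import Data.Nat.Tactic.RingSolver as ℕSolver
  open import Data.Product using (_×_; _,_; proj₁; ∃-syntax)
  open import Data.Sum using (reduce)
  open import Relation.Nullary using (yes; no; contradiction)
  open import Relation.Binary.PropositionalEquality

  prime-∣-square : ∀ {p a} → Prime p → p ∣ a * a → p ∣ a
  prime-∣-square {p} {a} p-prime p∣a² = reduce (euclidsLemma a a p-prime p∣a²)

  -- (t, v) is a unit of the norm form t² + tv - v², i.e. t² + tv = v² + 1.
  Unit : ℕ → ℕ → Set
  Unit t v = t * t + t * v ≡ v * v + 1

  -- Under the substitution (e, d) ↦ (e + d, e + 2d) both sides of the unit
  -- equation grow by the same amount e² + 4ed + 3d², so the substitution and its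
  -- inverse preserve units.
  growth : ℕ → ℕ → ℕ
  growth e d = e * e + 4 * e * d + 3 * d * d

  growth-left : ∀ e d → (e + d) * (e + d) + (e + d) * (e + 2 * d) ≡ (e * e + e * d) + (e * e + 4 * e * d + 3 * d * d)
  growth-left = ℕSolver.solve-∀

  growth-right : ∀ e d → (e + 2 * d) * (e + 2 * d) + 1 ≡ (d * d + 1) + (e * e + 4 * e * d + 3 * d * d)
  growth-right = ℕSolver.solve-∀

  unit-step : ∀ e d → Unit e d → Unit (e + d) (e + 2 * d)
  unit-step e d u = begin
      (e + d) * (e + d) + (e + d) * (e + 2 * d)   ≡⟨ growth-left e d ⟩
      (e * e + e * d) + growth e d                ≡⟨ cong (_+ growth e d) u ⟩
      (d * d + 1) + growth e d                    ≡⟨ growth-right e d ⟨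
      (e + 2 * d) * (e + 2 * d) + 1               ∎
    where open ≡-Reasoning

  unit-step⁻¹ : ∀ e d → Unit (e + d) (e + 2 * d) → Unit e d
  unit-step⁻¹ e d u = +-cancelʳ-≡ (growth e d) (e * e + e * d) (d * d + 1) (begin
      (e * e + e * d) + growth e d                ≡⟨ growth-left e d ⟨
      (e + d) * (e + d) + (e + d) * (e + 2 * d)   ≡⟨ u ⟩
      (e + 2 * d) * (e + 2 * d) + 1               ≡⟨ growth-right e d ⟩
      (d * d + 1) + growth e d                    ∎)
    where open ≡-Reasoning

  -- For a unit with v ≥ 1 we have t ≤ v: otherwise t² + tv > v² + 1.
  unit⇒t≤v : ∀ {t v} → 1 ≤ v → Unit t v → t ≤ v
  unit⇒t≤v {t} {v} 1≤v u with t ≤? v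
  ... | yes t≤v = t≤v
  ... | no t≰v = contradiction (sym u) (<⇒≢ too-big)
    where
    v<t : v < t
    v<t = ≰⇒> t≰v
    too-big : v * v + 1 < t * t + t * v
    too-big = +-mono-<-≤ (*-mono-< v<t v<t) (*-mono-≤ (≤-trans 1≤v (<⇒≤ v<t)) 1≤v)

  -- For a unit with v ≥ 1 we have v ≤ 2t: otherwise t² + tv ≤ 2tv < v².
  unit⇒v≤2t : ∀ {t v} → 1 ≤ v → Unit t v → v ≤ 2 * t
  unit⇒v≤2t {t} {v} 1≤v u with v ≤? 2 * t
  ... | yes v≤2t = v≤2t
  ... | no v≰2t = contradiction u (<⇒≢ too-small)
    where
    instance
      _ : ℕ.NonZero v
      _ = ℕ.>-nonZero 1≤v
    open ≤-Reasoning
    too-small : t * t + t * v < v * v + 1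
    too-small = begin-strict
      t * t + t * v     ≤⟨ +-monoˡ-≤ (t * v) (*-monoʳ-≤ t (unit⇒t≤v {t} 1≤v u)) ⟩
      t * v + t * v     ≡⟨ double t v ⟩
      (2 * t) * v       <⟨ *-monoˡ-< v (≰⇒> v≰2t) ⟩
      v * v             <⟨ m<m+n (v * v) z<s ⟩
      v * v + 1         ∎
      where
      double : ∀ t v → t * v + t * v ≡ (2 * t) * v
      double = ℕSolver.solve-∀

  -- Descent: a unit (t, v) with v ≥ 1 is the image of a smaller unit (e, d)
  -- under (e, d) ↦ (e + d, e + 2d), namely e = 2t - v and d = v - t.
  unit-descent : ∀ {t v} → 1 ≤ v → Unit t v →
    ∃[ e ] ∃[ d ] (t ≡ e + d × v ≡ e + 2 * d × d < v × Unit e d)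
  unit-descent {t} {v} 1≤v u = e , d , t≡e+d , v≡e+2d , d<v , unit-step⁻¹ e d u′
    where
    t≤v : t ≤ v
    t≤v = unit⇒t≤v {t} 1≤v u
    v≤2t : v ≤ 2 * t
    v≤2t = unit⇒v≤2t {t} 1≤v u
    d = v ∸ t
    e = 2 * t ∸ v
    t+d≡v : t + d ≡ v
    t+d≡v = m+[n∸m]≡n t≤v
    t≡e+d : t ≡ e + d
    t≡e+d = +-cancelˡ-≡ t t (e + d) (begin
      t + t              ≡⟨ cong (t +_) (+-identityʳ t) ⟨
      2 * t              ≡⟨ m+[n∸m]≡n v≤2t ⟨
      v + e              ≡⟨ cong (_+ e) t+d≡v ⟨
      t + d + e          ≡⟨ +-assoc t d e ⟩
      t + (d + e)        ≡⟨ cong (t +_) (+-comm d e) ⟩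
      t + (e + d)        ∎)
      where open ≡-Reasoning
    v≡e+2d : v ≡ e + 2 * d
    v≡e+2d = begin
      v                  ≡⟨ t+d≡v ⟨
      t + d              ≡⟨ cong (_+ d) t≡e+d ⟩
      e + d + d          ≡⟨ regroup e d ⟩
      e + 2 * d          ∎
      where
      open ≡-Reasoning
      regroup : ∀ e d → e + d + d ≡ e + 2 * d
      regroup = ℕSolver.solve-∀
    positive : ∀ {s} → v ≤ 2 * s → 1 ≤ s
    positive {suc _} _ = s≤s z≤n
    positive {zero} v≤0 = contradiction v≤0 (<⇒≱ 1≤v)
    d<v : d < v
    d<v = subst (d <_) t+d≡v (m<n+m d (positive v≤2t))
    u′ : Unit (e + d) (e + 2 * d)
    u′ = subst₂ Unit t≡e+d v≡e+2d u

  -- The units are exactly the pairs (U k, V k) = (F₂ₖ₋₁, F₂ₖ) of consecutive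
  -- Fibonacci numbers, obtained from (1, 0) by iterating (e, d) ↦ (e + d, e + 2d).
  mutual
    U : ℕ → ℕ
    U zero = 1
    U (suc k) = U k + V k

    V : ℕ → ℕ
    V zero = 0
    V (suc k) = U k + 2 * V k

  UV-unit : ∀ k → Unit (U k) (V k)
  UV-unit zero = refl
  UV-unit (suc k) = unit-step (U k) (V k) (UV-unit k)

  unit-classification : ∀ v t → Unit t v → ∃[ k ] (t ≡ U k × v ≡ V k)
  unit-classification = <-rec (λ v → ∀ t → Unit t v → ∃[ k ] (t ≡ U k × v ≡ V k)) classify
    where
    classify : ∀ v → (∀ {w} → w < v → ∀ t → Unit t w → ∃[ k ] (t ≡ U k × w ≡ V k)) →
               ∀ t → Unit t v → ∃[ k ] (t ≡ U k × v ≡ V k)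
    classify zero _ zero ()
    classify zero _ (suc zero) _ = 0 , refl , refl
    classify zero _ (suc (suc t)) ()
    classify (suc v) descend t u with unit-descent (s≤s z≤n) u
    ... | e , d , t≡e+d , v≡e+2d , d<v , unit-ed with descend d<v e unit-ed
    ...   | k , e≡U , d≡V =
            suc k , trans t≡e+d (cong₂ _+_ e≡U d≡V) , trans v≡e+2d (cong₂ (λ a b → a + 2 * b) e≡U d≡V)

  L-via-UV : ∀ k → L (2 * k) ≡ V k + 2 * U k × L (1 + 2 * k) ≡ U k + 3 * V k
  L-via-UV zero = refl , refl
  L-via-UV (suc k) with L-via-UV k
  ... | even , odd = even′ , odd′
    where
    open ≡-Reasoning
    2+2k : 2 * suc k ≡ 2 + 2 * k
    2+2k = cong suc (+-suc k (k + 0))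
    even′ : L (2 * suc k) ≡ V (suc k) + 2 * U (suc k)
    even′ = begin
      L (2 * suc k)                               ≡⟨ cong L 2+2k ⟩
      L (1 + 2 * k) + L (2 * k)                   ≡⟨ cong₂ _+_ odd even ⟩
      (U k + 3 * V k) + (V k + 2 * U k)           ≡⟨ regroup (U k) (V k) ⟩
      V (suc k) + 2 * U (suc k)                   ∎
      where
      regroup : ∀ u v → (u + 3 * v) + (v + 2 * u) ≡ (u + 2 * v) + 2 * (u + v)
      regroup = ℕSolver.solve-∀
    odd′ : L (1 + 2 * suc k) ≡ U (suc k) + 3 * V (suc k)
    odd′ = begin
      L (1 + 2 * suc k)                                     ≡⟨ cong (λ i → L (1 + i)) 2+2k ⟩
      (L (1 + 2 * k) + L (2 * k)) + L (1 + 2 * k)           ≡⟨ cong₂ (λ a b → (a + b) + a) odd even ⟩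
      ((U k + 3 * V k) + (V k + 2 * U k)) + (U k + 3 * V k) ≡⟨ regroup (U k) (V k) ⟩
      U (suc k) + 3 * V (suc k)                             ∎
      where
      regroup : ∀ u v → ((u + 3 * v) + (v + 2 * u)) + (u + 3 * v) ≡ (u + v) + 3 * (u + 2 * v)
      regroup = ℕSolver.solve-∀

  L-even-pell : ∀ k → L (2 * k) * L (2 * k) ≡ 5 * (V k * V k) + 4
  L-even-pell k = begin
      L (2 * k) * L (2 * k)                 ≡⟨ cong (λ x → x * x) (proj₁ (L-via-UV k)) ⟩
      (V k + 2 * U k) * (V k + 2 * U k)     ≡⟨ expand (U k) (V k) ⟩
      V k * V k + 4 * (U k * U k + U k * V k) ≡⟨ cong (λ n → V k * V k + 4 * n) (UV-unit k) ⟩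
      V k * V k + 4 * (V k * V k + 1)       ≡⟨ collect (V k) ⟩
      5 * (V k * V k) + 4                   ∎
    where
    open ≡-Reasoning
    expand : ∀ u v → (v + 2 * u) * (v + 2 * u) ≡ v * v + 4 * (u * u + u * v)
    expand = ℕSolver.solve-∀
    collect : ∀ v → v * v + 4 * (v * v + 1) ≡ 5 * (v * v) + 4
    collect = ℕSolver.solve-∀

  -- In a solution of x² = 5u² + 4 we have u ≤ x ...
  pell-u≤x : ∀ {x u} → x * x ≡ 5 * (u * u) + 4 → u ≤ x
  pell-u≤x {x} {u} pell with u ≤? x
  ... | yes u≤x = u≤x
  ... | no u≰x = contradiction pell (<⇒≢ (begin-strict
          x * x               <⟨ *-mono-< (≰⇒> u≰x) (≰⇒> u≰x) ⟩
          u * u               ≤⟨ m≤n*m (u * u) 5 ⟩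
          5 * (u * u)         ≤⟨ m≤m+n (5 * (u * u)) 4 ⟩
          5 * (u * u) + 4     ∎))
    where open ≤-Reasoning

  -- ... the gap r = x - u is even, since r² + 2ur = 4(u² + 1) ...
  pell-gap-even : ∀ {u r} → (u + r) * (u + r) ≡ 5 * (u * u) + 4 → 2 ∣ r
  pell-gap-even {u} {r} pell = prime-∣-square prime[2] 2∣r²
    where
    expand : ∀ u r → (u + r) * (u + r) ≡ u * u + (2 * (u * r) + r * r)
    expand = ℕSolver.solve-∀
    collect : ∀ u → 5 * (u * u) + 4 ≡ u * u + 2 * (2 * (u * u + 1))
    collect = ℕSolver.solve-∀
    reduced : 2 * (u * r) + r * r ≡ 2 * (2 * (u * u + 1))
    reduced = +-cancelˡ-≡ (u * u) _ _ (trans (sym (expand u r)) (trans pell (collect u)))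
    2∣r² : 2 ∣ r * r
    2∣r² = ∣m+n∣m⇒∣n (divides (2 * (u * u + 1)) (trans reduced (*-comm 2 (2 * (u * u + 1)))))
                      (divides (u * r) (*-comm 2 (u * r)))

  -- ... and with r = 2q the pair (q, u) is a unit: 4(q² + qu) = 4(u² + 1).
  pell-unit : ∀ {u q} → (u + q * 2) * (u + q * 2) ≡ 5 * (u * u) + 4 → Unit q u
  pell-unit {u} {q} pell = *-cancelˡ-≡ _ _ 4 (+-cancelˡ-≡ (u * u) _ _ (trans (sym (expand u q)) (trans pell (collect u))))
    where
    expand : ∀ u q → (u + q * 2) * (u + q * 2) ≡ u * u + 4 * (q * q + q * u)
    expand = ℕSolver.solve-∀
    collect : ∀ u → 5 * (u * u) + 4 ≡ u * u + 4 * (u * u + 1)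
    collect = ℕSolver.solve-∀

  -- Hence every solution of x² = 5u² + 4 has x = u + 2q = F₂ₖ + 2F₂ₖ₋₁ = L₂ₖ.
  pell-solutions : ∀ x u → x * x ≡ 5 * (u * u) + 4 → ∃[ k ] x ≡ L (2 * k)
  pell-solutions x u pell with m≤n⇒∃[o]m+o≡n (pell-u≤x {x} {u} pell)
  ... | r , refl with pell-gap-even {u} {r} pell
  ... | divides q refl with unit-classification u q (pell-unit {u} {q} pell)
  ...   | k , q≡U , u≡V = k , (begin
            u + q * 2           ≡⟨ cong₂ (λ a b → a + b * 2) u≡V q≡U ⟩
            V k + U k * 2       ≡⟨ cong (V k +_) (*-comm (U k) 2) ⟩
            V k + 2 * U k       ≡⟨ proj₁ (L-via-UV k) ⟨
            L (2 * k)           ∎)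
    where open ≡-Reasoning

module Discriminant where

  open EvenLucas
  open Vieta
  open Pell
  open import Data.Nat as ℕ using (ℕ; zero; suc; _+_; _*_; _∸_; _≤_; NonZero; z≤n; s≤s)
  open import Data.Nat.Properties
  open import Data.Nat.Divisibility using (_∣_; divides; quotient; ∣-refl; ∣-trans; m∣m*n; *-cancelˡ-∣)
  open import Data.Nat.GCD using (gcd; gcd[m,n]∣m; gcd[m,n]∣n; gcd[m,n]≢0)
  open import Data.Nat.Coprimality using (coprime-/gcd; coprime-divisor)
  open import Data.Nat.DivMod using (_/_; m/n*n≡m)
  open import Data.Nat.Primality using (Prime; prime⇒nonZero; prime?)
  import Data.Nat.Tactic.RingSolver as ℕSolver
  import Data.Integer as ℤ
  open ℤ using (+_)
  import Data.Integer.Properties as ℤP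
  open import Data.Integer.Tactic.RingSolver using (solve-∀)
  open import Relation.Nullary.Decidable using (from-yes)
  open import Data.Product using (_,_; proj₁; proj₂; ∃-syntax)
  open import Data.Sum using (inj₁)
  open import Relation.Binary.PropositionalEquality

  -- If a² divides b² then a divides b: dividing by g = gcd a b leaves coprime
  -- a′, b′ with a′² ∣ b′², which forces a′ = 1, i.e. a = g.
  square-∣-square : ∀ {a b} .{{_ : NonZero a}} → a * a ∣ b * b → a ∣ b
  square-∣-square {a} {b} a²∣b² = subst (_∣ b) (sym a≡g) (gcd[m,n]∣n a b)
    where
    open ≡-Reasoning
    g = gcd a b
    instance
      _ : NonZero g
      _ = ℕ.≢-nonZero (gcd[m,n]≢0 a b (inj₁ (ℕ.≢-nonZero⁻¹ a)))
      _ : NonZero (g * g)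
      _ = m*n≢0 g g
    a′ = a / g
    b′ = b / g
    a′g≡a : a′ * g ≡ a
    a′g≡a = m/n*n≡m (gcd[m,n]∣m a b)
    b′g≡b : b′ * g ≡ b
    b′g≡b = m/n*n≡m (gcd[m,n]∣n a b)
    regroup : ∀ x g → (x * g) * (x * g) ≡ (g * g) * (x * x)
    regroup = ℕSolver.solve-∀
    a′²∣b′² : a′ * a′ ∣ b′ * b′
    a′²∣b′² = *-cancelˡ-∣ (g * g) (subst₂ _∣_
      (trans (cong (λ x → x * x) (sym a′g≡a)) (regroup a′ g))
      (trans (cong (λ x → x * x) (sym b′g≡b)) (regroup b′ g)) a²∣b²)
    a′∣b′ : a′ ∣ b′
    a′∣b′ = coprime-divisor (coprime-/gcd a b) (∣-trans (m∣m*n a′) a′²∣b′²)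
    a≡g : a ≡ g
    a≡g = begin
      a         ≡⟨ a′g≡a ⟨
      a′ * g    ≡⟨ cong (_* g) (coprime-/gcd a b (∣-refl , a′∣b′)) ⟩
      1 * g     ≡⟨ *-identityˡ g ⟩
      g         ∎

  -- If v²·p·c is a perfect square (p prime, v ≠ 0) then c is p times a square:
  -- v divides s = w·v, so w² = p·c, hence p ∣ w = u·p and c = p·u².
  square-times-prime : ∀ {p v s c} .{{_ : NonZero v}} → Prime p →
                       s * s ≡ (v * v) * (p * c) → ∃[ u ] c ≡ p * (u * u)
  square-times-prime {p} {v} {s} {c} p-prime s²≡v²pc = u , c≡pu²
    where
    open ≡-Reasoning
    instance
      _ : NonZero (v * v)
      _ = m*n≢0 v v
      _ : NonZero p
      _ = prime⇒nonZero p-prime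
    v∣s : v ∣ s
    v∣s = square-∣-square (divides (p * c) (trans s²≡v²pc (*-comm (v * v) (p * c))))
    w = quotient v∣s
    regroup : ∀ w v → (w * v) * (w * v) ≡ (w * w) * (v * v)
    regroup = ℕSolver.solve-∀
    w²≡cp : w * w ≡ c * p
    w²≡cp = *-cancelʳ-≡ (w * w) (c * p) (v * v) (begin
      (w * w) * (v * v)    ≡⟨ regroup w v ⟨
      (w * v) * (w * v)    ≡⟨ cong (λ x → x * x) (_∣_.equality v∣s) ⟨
      s * s                ≡⟨ s²≡v²pc ⟩
      (v * v) * (p * c)    ≡⟨ *-comm (v * v) (p * c) ⟩
      (p * c) * (v * v)    ≡⟨ cong (_* (v * v)) (*-comm p c) ⟩
      (c * p) * (v * v)    ∎)
    p∣w : p ∣ w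
    p∣w = prime-∣-square p-prime (divides c w²≡cp)
    u = quotient p∣w
    regroup′ : ∀ u p → (u * p) * (u * p) ≡ (p * (u * u)) * p
    regroup′ = ℕSolver.solve-∀
    c≡pu² : c ≡ p * (u * u)
    c≡pu² = *-cancelʳ-≡ c (p * (u * u)) p (begin
      c * p                ≡⟨ w²≡cp ⟨
      w * w                ≡⟨ cong (λ x → x * x) (_∣_.equality p∣w) ⟩
      (u * p) * (u * p)    ≡⟨ regroup′ u p ⟩
      (p * (u * u)) * p    ∎)

  prime[5] : Prime 5
  prime[5] = from-yes (prime? 5)

  U-positive : ∀ k → 1 ≤ U k
  U-positive zero = s≤s z≤n
  U-positive (suc k) = ≤-trans (U-positive k) (m≤m+n (U k) (V k))

  V-positive : ∀ k → 1 ≤ k → 1 ≤ V k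
  V-positive (suc k) _ = ≤-trans (U-positive k) (m≤m+n (U k) (2 * V k))

  discriminant : ∀ x c y → Lucas-equation x c y →
    (+ 2 ℤ.* y ℤ.- c ℤ.* x) ℤ.* (+ 2 ℤ.* y ℤ.- c ℤ.* x) ≡ (c ℤ.* c ℤ.- + 4) ℤ.* (x ℤ.* x ℤ.- + 4)
  discriminant x c y eq = begin
      (+ 2 ℤ.* y ℤ.- c ℤ.* x) ℤ.* (+ 2 ℤ.* y ℤ.- c ℤ.* x)
        ≡⟨ complete x c y ⟩
      (c ℤ.* c ℤ.- + 4) ℤ.* (x ℤ.* x ℤ.- + 4)
        ℤ.+ + 4 ℤ.* ((x ℤ.* x ℤ.+ y ℤ.* y ℤ.+ c ℤ.* c) ℤ.- (c ℤ.* x ℤ.* y ℤ.+ + 4))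
        ≡⟨ cong (λ t → (c ℤ.* c ℤ.- + 4) ℤ.* (x ℤ.* x ℤ.- + 4) ℤ.+ + 4 ℤ.* t) (ℤP.i≡j⇒i-j≡0 eq) ⟩
      (c ℤ.* c ℤ.- + 4) ℤ.* (x ℤ.* x ℤ.- + 4) ℤ.+ + 4 ℤ.* + 0
        ≡⟨ drop-zero ((c ℤ.* c ℤ.- + 4) ℤ.* (x ℤ.* x ℤ.- + 4)) ⟩
      (c ℤ.* c ℤ.- + 4) ℤ.* (x ℤ.* x ℤ.- + 4)
        ∎
    where
    open ≡-Reasoning
    complete : ∀ x c y → (+ 2 ℤ.* y ℤ.- c ℤ.* x) ℤ.* (+ 2 ℤ.* y ℤ.- c ℤ.* x)
      ≡ (c ℤ.* c ℤ.- + 4) ℤ.* (x ℤ.* x ℤ.- + 4)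
        ℤ.+ + 4 ℤ.* ((x ℤ.* x ℤ.+ y ℤ.* y ℤ.+ c ℤ.* c) ℤ.- (c ℤ.* x ℤ.* y ℤ.+ + 4))
    complete = solve-∀
    drop-zero : ∀ a → a ℤ.+ + 4 ℤ.* + 0 ≡ a
    drop-zero = solve-∀

  cast-∸4 : ∀ {a b} → a ≡ b + 4 → + a ℤ.- + 4 ≡ + b
  cast-∸4 {a} {b} refl = begin
      + (b + 4) ℤ.- + 4         ≡⟨ cong (ℤ._- + 4) (ℤP.pos-+ b 4) ⟩
      (+ b ℤ.+ + 4) ℤ.- + 4     ≡⟨ cancel (+ b) ⟩
      + b                       ∎
    where
    open ≡-Reasoning
    cancel : ∀ t → (t ℤ.+ + 4) ℤ.- + 4 ≡ t
    cancel = solve-∀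

  -- If x ≥ 2 and some y solves the equation with c = L₂ₘ (m ≥ 1), then x is an
  -- even-index Lucas number: c² - 4 = 5F₂ₘ², so by the discriminant
  -- 5F₂ₘ²(x² - 4) is a square, hence x² - 4 = 5u² and x² = 5u² + 4.
  first-coordinate-Lucas : ∀ m x y → 1 ≤ m → 2 ≤ x → Lucas-equation (+ x) (Λ m) y →
                           ∃[ k ] x ≡ L (2 * k)
  first-coordinate-Lucas m x y 1≤m 2≤x eq = pell-solutions x u x²≡5u²+4
    where
    open ≡-Reasoning
    v = V m
    instance
      _ : NonZero v
      _ = ℕ.>-nonZero (V-positive m 1≤m)
    c = x * x ∸ 4
    x²≡c+4 : x * x ≡ c + 4
    x²≡c+4 = sym (m∸n+n≡m (*-mono-≤ 2≤x 2≤x))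
    Z = + 2 ℤ.* y ℤ.- Λ m ℤ.* + x
    Z²≡ : Z ℤ.* Z ≡ + ((v * v) * (5 * c))
    Z²≡ = begin
      Z ℤ.* Z                                                  ≡⟨ discriminant (+ x) (Λ m) y eq ⟩
      (Λ m ℤ.* Λ m ℤ.- + 4) ℤ.* (+ x ℤ.* + x ℤ.- + 4)           ≡⟨ cong₂ (λ a b → (a ℤ.- + 4) ℤ.* (b ℤ.- + 4))
                                                                        (ℤP.pos-* (L (2 * m)) (L (2 * m)))
                                                                        (ℤP.pos-* x x) ⟨
      (+ (L (2 * m) * L (2 * m)) ℤ.- + 4) ℤ.* (+ (x * x) ℤ.- + 4) ≡⟨ cong₂ ℤ._*_ (cast-∸4 (L-even-pell m)) (cast-∸4 x²≡c+4) ⟩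
      + (5 * (v * v)) ℤ.* + c                                  ≡⟨ ℤP.pos-* (5 * (v * v)) c ⟨
      + (5 * (v * v) * c)                                      ≡⟨ cong +_ (regroup v c) ⟩
      + ((v * v) * (5 * c))                                    ∎
      where
      regroup : ∀ v c → 5 * (v * v) * c ≡ (v * v) * (5 * c)
      regroup = ℕSolver.solve-∀
    ∣Z∣² : ℤ.∣ Z ∣ * ℤ.∣ Z ∣ ≡ (v * v) * (5 * c)
    ∣Z∣² = trans (sym (ℤP.abs-* Z Z)) (cong ℤ.∣_∣ Z²≡)
    c-is-5-square : ∃[ u ] c ≡ 5 * (u * u)
    c-is-5-square = square-times-prime {5} {v} {ℤ.∣ Z ∣} {c} prime[5] ∣Z∣²
    u = proj₁ c-is-5-square
    x²≡5u²+4 : x * x ≡ 5 * (u * u) + 4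
    x²≡5u²+4 = trans x²≡c+4 (cong (_+ 4) (proj₂ c-is-5-square))

module LucasEquation where

  open EvenLucas
  open Vieta
  open Discriminant
  open import Data.Nat using (ℕ; _+_; _*_; _∸_; _≤_)
  open import Data.Nat.Properties
  import Data.Integer as ℤ
  open ℤ using (+_)
  import Data.Integer.Properties as ℤP
  open import Data.Product using (_×_; _,_; ∃-syntax)
  open import Data.Sum using (_⊎_; inj₁; inj₂)
  open import Relation.Binary.PropositionalEquality

  cast-equation : ∀ x c y → x * x + y * y + c * c ≡ c * x * y + 4 → Lucas-equation (+ x) (+ c) (+ y)
  cast-equation x c y eq = begin
      + x ℤ.* + x ℤ.+ + y ℤ.* + y ℤ.+ + c ℤ.* + c
        ≡⟨ cong₂ ℤ._+_ (cong₂ ℤ._+_ (ℤP.pos-* x x) (ℤP.pos-* y y)) (ℤP.pos-* c c) ⟨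
      + (x * x) ℤ.+ + (y * y) ℤ.+ + (c * c)
        ≡⟨ cong (ℤ._+ + (c * c)) (ℤP.pos-+ (x * x) (y * y)) ⟨
      + (x * x + y * y) ℤ.+ + (c * c)
        ≡⟨ ℤP.pos-+ (x * x + y * y) (c * c) ⟨
      + (x * x + y * y + c * c)
        ≡⟨ cong +_ eq ⟩
      + (c * x * y + 4)
        ≡⟨ ℤP.pos-+ (c * x * y) 4 ⟩
      + (c * x * y) ℤ.+ + 4
        ≡⟨ cong (ℤ._+ + 4) (trans (ℤP.pos-* (c * x) y) (cong (ℤ._* + y) (ℤP.pos-* c x))) ⟩
      + c ℤ.* + x ℤ.* + y ℤ.+ + 4
        ∎
    where open ≡-Reasoning

  Lucas-pair : ℕ → ℕ → ℕ → Set
  Lucas-pair m x y = (∃[ k ] (x ≡ L (2 * k) × y ≡ L (2 * k + 2 * m)))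
                   ⊎ (∃[ k ] (y ≡ L (2 * k) × x ≡ L (2 * k + 2 * m)))
                   ⊎ (∃[ k ] (k ≤ m × x ≡ L (2 * k) × y ≡ L (2 * m ∸ 2 * k)))

  -- Every natural solution of x² + y² + L₂ₘ² = L₂ₘ x y + 4 with m ≥ 1 and
  -- x ≥ 2 is a Lucas pair: x = L₂ₖ by the discriminant argument, and then y is
  -- one of the two roots of the quadratic.
  lucas-equation-solutions : ∀ m x y → 1 ≤ m → 2 ≤ x →
    x * x + y * y + L (2 * m) * L (2 * m) ≡ L (2 * m) * x * y + 4 → Lucas-pair m x y
  lucas-equation-solutions m x y 1≤m 2≤x eq =
    x-Lucas (first-coordinate-Lucas m x (+ y) 1≤m 2≤x (cast-equation x (L (2 * m)) y eq))
    where
    y-root : ∀ k → + y ≡ Λ (k + m) ⊎ (k ≤ m × + y ≡ Λ (m ∸ k)) ⊎ (m ≤ k × + y ≡ Λ (k ∸ m)) →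
             Lucas-pair m (L (2 * k)) y
    y-root k (inj₁ y≡) = inj₁ (k , refl , trans (ℤP.+-injective y≡) (cong L (*-distribˡ-+ 2 k m)))
    y-root k (inj₂ (inj₁ (k≤m , y≡))) =
      inj₂ (inj₂ (k , k≤m , refl , trans (ℤP.+-injective y≡) (cong L (*-distribˡ-∸ 2 m k))))
    y-root k (inj₂ (inj₂ (m≤k , y≡))) = inj₂ (inj₁ (k ∸ m , ℤP.+-injective y≡ , cong L x-index))
      where
      x-index : 2 * k ≡ 2 * (k ∸ m) + 2 * m
      x-index = trans (cong (2 *_) (sym (m∸n+n≡m m≤k))) (*-distribˡ-+ 2 (k ∸ m) m)
    x-Lucas : (∃[ k ] x ≡ L (2 * k)) → Lucas-pair m x y
    x-Lucas (k , refl) = y-root k (Λ-solutions k m (+ y) (cast-equation (L (2 * k)) (L (2 * m)) y eq))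

module FiniteSums where

  open import Data.Nat as ℕ using (ℕ; zero; suc; _+_; _*_; _^_; _≤_; _<_; _≟_; _≡ᵇ_; s≤s)
  open import Data.Nat.Properties
  open import Data.Nat.Divisibility using (_∣_; _∣?_; ∣⇒≤)
  open import Data.Nat.ListAction using (sum)
  open import Data.List using (List; []; _∷_; map; filter; applyUpTo)
  open import Data.List.Membership.Propositional using (_∈_; _∉_)
  open import Data.List.Relation.Unary.All as All using (All; []; _∷_)
  open import Data.List.Relation.Unary.AllPairs using ([]; _∷_)
  open import Data.List.Relation.Unary.Any using (here; there)
  open import Data.List.Relation.Unary.Unique.Propositional using (Unique)
  open import Data.Bool using (true; false; if_then_else_)
  open import Data.Unit using (tt)
  open import Relation.Nullary using (¬_; does; yes; no; contradiction)
  open import Relation.Binary.PropositionalEquality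

  Σ< : ℕ → (ℕ → ℕ) → ℕ
  Σ< zero f = 0
  Σ< (suc N) f = f 0 + Σ< N (λ i → f (suc i))

  Σ<-zero : ∀ N {f} → (∀ i → f i ≡ 0) → Σ< N f ≡ 0
  Σ<-zero zero f≡0 = refl
  Σ<-zero (suc N) f≡0 = cong₂ _+_ (f≡0 0) (Σ<-zero N (λ i → f≡0 (suc i)))

  erase : ℕ → (ℕ → ℕ) → ℕ → ℕ
  erase a f i = if i ≡ᵇ a then 0 else f i

  erase-at : ∀ a f → erase a f a ≡ 0
  erase-at a f with a ≡ᵇ a | ≡⇒≡ᵇ a a refl
  ... | true | _ = refl

  erase-off : ∀ {a i} f → i ≢ a → erase a f i ≡ f i
  erase-off {a} {i} f i≢a with i ≡ᵇ a | ≡ᵇ⇒≡ i a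
  ... | true | i≡a = contradiction (i≡a tt) i≢a
  ... | false | _ = refl

  Σ<-erase : ∀ N a f → a < N → Σ< N f ≡ f a + Σ< N (erase a f)
  Σ<-erase (suc N) zero f _ = refl
  Σ<-erase (suc N) (suc a) f (s≤s a<N) = begin
      f 0 + Σ< N (λ i → f (suc i))                          ≡⟨ cong (f 0 +_) (Σ<-erase N a (λ i → f (suc i)) a<N) ⟩
      f 0 + (f (suc a) + Σ< N (erase a (λ i → f (suc i))))  ≡⟨ +-assoc (f 0) (f (suc a)) _ ⟨
      f 0 + f (suc a) + Σ< N (erase a (λ i → f (suc i)))    ≡⟨ cong (_+ Σ< N (erase a (λ i → f (suc i)))) (+-comm (f 0) (f (suc a))) ⟩
      f (suc a) + f 0 + Σ< N (erase a (λ i → f (suc i)))    ≡⟨ +-assoc (f (suc a)) (f 0) _ ⟩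
      f (suc a) + (f 0 + Σ< N (erase a (λ i → f (suc i))))  ∎
    where open ≡-Reasoning

  erase-all : List ℕ → (ℕ → ℕ) → ℕ → ℕ
  erase-all [] f = f
  erase-all (a ∷ as) f = erase a (erase-all as f)

  erase-all-outside : ∀ {a} as f → All (a ≢_) as → erase-all as f a ≡ f a
  erase-all-outside [] f [] = refl
  erase-all-outside (b ∷ bs) f (a≢b ∷ a∉bs) = trans (erase-off (erase-all bs f) a≢b) (erase-all-outside bs f a∉bs)

  erase-all-vanishes : ∀ as f i → (i ∉ as → f i ≡ 0) → erase-all as f i ≡ 0
  erase-all-vanishes [] f i vanish = vanish (λ ())
  erase-all-vanishes (a ∷ as) f i vanish with i ≟ a
  ... | yes refl = erase-at i (erase-all as f)
  ... | no i≢a = trans (erase-off (erase-all as f) i≢a)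
                       (erase-all-vanishes as f i (λ i∉as → vanish λ { (here i≡a) → i≢a i≡a ; (there i∈as) → i∉as i∈as }))

  Σ<-erase-all : ∀ N as f → Unique as → All (_< N) as →
                 Σ< N f ≡ sum (map f as) + Σ< N (erase-all as f)
  Σ<-erase-all N [] f [] [] = refl
  Σ<-erase-all N (a ∷ as) f (a∉as ∷ unique) (a<N ∷ as<N) = begin
      Σ< N f
        ≡⟨ Σ<-erase-all N as f unique as<N ⟩
      sum (map f as) + Σ< N (erase-all as f)
        ≡⟨ cong (sum (map f as) +_) (Σ<-erase N a (erase-all as f) a<N) ⟩
      sum (map f as) + (erase-all as f a + Σ< N (erase a (erase-all as f)))
        ≡⟨ cong (λ t → sum (map f as) + (t + Σ< N (erase a (erase-all as f)))) (erase-all-outside as f a∉as) ⟩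
      sum (map f as) + (f a + Σ< N (erase a (erase-all as f)))
        ≡⟨ +-assoc (sum (map f as)) (f a) _ ⟨
      sum (map f as) + f a + Σ< N (erase a (erase-all as f))
        ≡⟨ cong (_+ Σ< N (erase a (erase-all as f))) (+-comm (sum (map f as)) (f a)) ⟩
      f a + sum (map f as) + Σ< N (erase a (erase-all as f))
        ∎
    where open ≡-Reasoning

  square : ℕ → ℕ
  square d = d * d

  divisor-square : ℕ → ℕ → ℕ
  divisor-square n d = if does (d ∣? n) then d * d else 0

  divisor-square-∣ : ∀ {n d} → d ∣ n → divisor-square n d ≡ d * d
  divisor-square-∣ {n} {d} d∣n with d ∣? n
  ... | yes _ = refl
  ... | no d∤n = contradiction d∣n d∤n

  divisor-square-∤ : ∀ {n d} → ¬ d ∣ n → divisor-square n d ≡ 0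
  divisor-square-∤ {n} {d} d∤n with d ∣? n
  ... | yes d∣n = contradiction d∣n d∤n
  ... | no _ = refl

  sum-squares-filter : ∀ n g N →
    sum (map (_^ 2) (filter (_∣? n) (applyUpTo g N))) ≡ Σ< N (λ i → divisor-square n (g i))
  sum-squares-filter n g zero = refl
  sum-squares-filter n g (suc N) with does (g 0 ∣? n)
  ... | true = cong₂ _+_ (cong (g 0 *_) (*-identityʳ (g 0))) (sum-squares-filter n (λ i → g (suc i)) N)
  ... | false = sum-squares-filter n (λ i → g (suc i)) N

  σ₂-as-Σ< : ∀ n → σ₂ n ≡ Σ< (suc n) (divisor-square n)
  σ₂-as-Σ< n = sum-squares-filter n (λ i → i) (suc n)

  σ₂-split : ∀ {n} ds → 1 ≤ n → Unique ds → All (_∣ n) ds →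
             σ₂ n ≡ sum (map square ds) + Σ< (suc n) (erase-all ds (divisor-square n))
  σ₂-split {n} ds 1≤n unique ds∣n = begin
      σ₂ n
        ≡⟨ σ₂-as-Σ< n ⟩
      Σ< (suc n) (divisor-square n)
        ≡⟨ Σ<-erase-all (suc n) ds (divisor-square n) unique (All.map (λ d∣n → s≤s (∣⇒≤ d∣n)) ds∣n) ⟩
      sum (map (divisor-square n) ds) + Σ< (suc n) (erase-all ds (divisor-square n))
        ≡⟨ cong (_+ Σ< (suc n) (erase-all ds (divisor-square n))) (sum-divisors ds ds∣n) ⟩
      sum (map square ds) + Σ< (suc n) (erase-all ds (divisor-square n))
        ∎
    where
    open ≡-Reasoning
    instance
      _ : ℕ.NonZero n
      _ = ℕ.>-nonZero 1≤n
    sum-divisors : ∀ ds → All (_∣ n) ds → sum (map (divisor-square n) ds) ≡ sum (map square ds)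
    sum-divisors [] [] = refl
    sum-divisors (d ∷ ds) (d∣n ∷ ds∣n) = cong₂ _+_ (divisor-square-∣ d∣n) (sum-divisors ds ds∣n)

  σ₂-lower : ∀ {n} ds → 1 ≤ n → Unique ds → All (_∣ n) ds → sum (map square ds) ≤ σ₂ n
  σ₂-lower {n} ds 1≤n unique ds∣n =
    subst (sum (map square ds) ≤_) (sym (σ₂-split ds 1≤n unique ds∣n)) (m≤m+n _ _)

  σ₂-exact : ∀ {n} ds → 1 ≤ n → Unique ds → All (_∣ n) ds → (∀ {d} → d ∣ n → d ∈ ds) →
             σ₂ n ≡ sum (map square ds)
  σ₂-exact {n} ds 1≤n unique ds∣n complete = begin
      σ₂ n                                                                  ≡⟨ σ₂-split ds 1≤n unique ds∣n ⟩
      sum (map square ds) + Σ< (suc n) (erase-all ds (divisor-square n))    ≡⟨ cong (sum (map square ds) +_) (Σ<-zero (suc n) rest-vanishes) ⟩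
      sum (map square ds) + 0                                               ≡⟨ +-identityʳ _ ⟩
      sum (map square ds)                                                   ∎
    where
    open ≡-Reasoning
    rest-vanishes : ∀ i → erase-all ds (divisor-square n) i ≡ 0
    rest-vanishes i = erase-all-vanishes ds (divisor-square n) i (λ i∉ds → divisor-square-∤ (λ i∣n → i∉ds (complete i∣n)))

module DivisorSums where

  open FiniteSums
  open import Data.Nat as ℕ using (ℕ; _+_; _*_; _≤_; _<_; NonZero)
  open import Data.Nat.Properties
  open import Data.Nat.Divisibility using (_∣_; _∣?_; divides; ∣-refl; 1∣_; m∣m*n; n∣m*n; *-cancelˡ-∣)
  open import Data.Nat.Coprimality using (Coprime; coprime-divisor)
  open import Data.Nat.Primality using (Prime; prime⇒irreducible; prime⇒nonZero; prime⇒nonTrivial)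
  import Data.Nat.Tactic.RingSolver as ℕSolver
  open import Data.List using ([]; _∷_)
  open import Data.List.Membership.Propositional using (_∈_)
  open import Data.List.Relation.Unary.All using ([]; _∷_)
  open import Data.List.Relation.Unary.AllPairs using ([]; _∷_)
  open import Data.List.Relation.Unary.Any using (here; there)
  open import Data.Sum using (inj₁; inj₂)
  open import Data.Product using (_,_)
  open import Relation.Nullary using (yes; no; contradiction)
  open import Relation.Binary.PropositionalEquality

  prime>1 : ∀ {p} → Prime p → 1 < p
  prime>1 {p} p-prime = ℕ.nonTrivial⇒n>1 p {{prime⇒nonTrivial p-prime}}

  divisors-of-prime : ∀ {p d} → Prime p → d ∣ p → d ∈ 1 ∷ p ∷ []
  divisors-of-prime p-prime d∣p with prime⇒irreducible p-prime d∣p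
  ... | inj₁ d≡1 = here d≡1
  ... | inj₂ d≡p = there (here d≡p)

  divisors-of-pq : ∀ {p q d} → Prime p → Prime q → d ∣ p * q → d ∈ 1 ∷ p ∷ q ∷ p * q ∷ []
  divisors-of-pq {p} {q} {d} p-prime q-prime d∣pq with p ∣? d
  ... | yes (divides e refl) with prime⇒irreducible q-prime e∣q
    where
    instance
      _ : NonZero p
      _ = prime⇒nonZero p-prime
    e∣q : e ∣ q
    e∣q = *-cancelˡ-∣ p (subst (_∣ p * q) (*-comm e p) d∣pq)
  ...   | inj₁ refl = there (here (*-identityˡ p))
  ...   | inj₂ refl = there (there (there (here (*-comm e p))))
  divisors-of-pq {p} {q} {d} p-prime q-prime d∣pq | no p∤d
    with prime⇒irreducible q-prime (coprime-divisor d⊥p d∣pq)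
    where
    d⊥p : Coprime d p
    d⊥p {i} (i∣d , i∣p) with prime⇒irreducible p-prime i∣p
    ... | inj₁ i≡1 = i≡1
    ... | inj₂ refl = contradiction i∣d p∤d
  ... | inj₁ d≡1 = here d≡1
  ... | inj₂ d≡q = there (there (here d≡q))

  σ₂-prime : ∀ {p} → Prime p → σ₂ p ≡ 1 + p * p
  σ₂-prime {p} p-prime =
    trans (σ₂-exact (1 ∷ p ∷ []) (<⇒≤ 1<p) unique (1∣ p ∷ ∣-refl ∷ []) (divisors-of-prime p-prime))
          (cong (1 +_) (+-identityʳ (p * p)))
    where
    1<p = prime>1 p-prime
    unique = (<⇒≢ 1<p ∷ []) ∷ [] ∷ []

  σ₂-semiprime : ∀ {p q} → Prime p → Prime q → p ≢ q → σ₂ (p * q) ≡ 1 + p * p + q * q + (p * q) * (p * q)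
  σ₂-semiprime {p} {q} p-prime q-prime p≢q =
    trans (σ₂-exact (1 ∷ p ∷ q ∷ p * q ∷ []) (<⇒≤ 1<pq) unique
                    (1∣ (p * q) ∷ m∣m*n q ∷ n∣m*n p ∷ ∣-refl ∷ [])
                    (divisors-of-pq p-prime q-prime))
          (regroup p q)
    where
    instance
      _ : NonZero p
      _ = prime⇒nonZero p-prime
    1<p = prime>1 p-prime
    1<q = prime>1 q-prime
    p<pq : p < p * q
    p<pq = m<m*n p q 1<q
    q<pq : q < p * q
    q<pq = subst (q <_) (*-comm q p) (m<m*n q p {{prime⇒nonZero q-prime}} 1<p)
    1<pq = <-trans 1<p p<pq
    unique = (<⇒≢ 1<p ∷ <⇒≢ 1<q ∷ <⇒≢ 1<pq ∷ [])
           ∷ (p≢q ∷ <⇒≢ p<pq ∷ [])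
           ∷ (<⇒≢ q<pq ∷ [])
           ∷ [] ∷ []
    regroup : ∀ p q → 1 * 1 + (p * p + (q * q + ((p * q) * (p * q) + 0))) ≡ 1 + p * p + q * q + (p * q) * (p * q)
    regroup = ℕSolver.solve-∀

  σ₂-prime-square : ∀ {p} → Prime p → σ₂ (p * p) ≡ 1 + p * p + (p * p) * (p * p)
  σ₂-prime-square {p} p-prime =
    trans (σ₂-exact (1 ∷ p ∷ p * p ∷ []) (<⇒≤ 1<pp) unique (1∣ (p * p) ∷ m∣m*n p ∷ ∣-refl ∷ []) complete)
          (regroup p)
    where
    instance
      _ : NonZero p
      _ = prime⇒nonZero p-prime
    1<p = prime>1 p-prime
    p<pp : p < p * p
    p<pp = m<m*n p p 1<p
    1<pp = <-trans 1<p p<pp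
    unique = (<⇒≢ 1<p ∷ <⇒≢ 1<pp ∷ []) ∷ (<⇒≢ p<pp ∷ []) ∷ [] ∷ []
    complete : ∀ {d} → d ∣ p * p → d ∈ 1 ∷ p ∷ p * p ∷ []
    complete d∣pp with divisors-of-pq p-prime p-prime d∣pp
    ... | here d≡1 = here d≡1
    ... | there (here d≡p) = there (here d≡p)
    ... | there (there (here d≡p)) = there (here d≡p)
    ... | there (there (there d∈pp)) = there (there d∈pp)
    regroup : ∀ p → 1 * 1 + (p * p + ((p * p) * (p * p) + 0)) ≡ 1 + p * p + (p * p) * (p * p)
    regroup = ℕSolver.solve-∀

  σ₂-proper-divisor : ∀ {n a} → a ∣ n → 1 < a → a < n → 1 + a * a + n * n ≤ σ₂ n
  σ₂-proper-divisor {n} {a} a∣n 1<a a<n =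
    subst (_≤ σ₂ n) (regroup a n) (σ₂-lower (1 ∷ a ∷ n ∷ []) (<⇒≤ 1<n) unique (1∣ n ∷ a∣n ∷ ∣-refl ∷ []))
    where
    1<n = <-trans 1<a a<n
    unique = (<⇒≢ 1<a ∷ <⇒≢ 1<n ∷ []) ∷ (<⇒≢ a<n ∷ []) ∷ [] ∷ []
    regroup : ∀ a n → 1 * 1 + (a * a + (n * n + 0)) ≡ 1 + a * a + n * n
    regroup = ℕSolver.solve-∀

module SolutionShapes where

  open DivisorSums
  open import Data.Nat as ℕ using (ℕ; suc; _+_; _*_; _≤_; _<_; z<s)
  open import Data.Nat.Properties
  open import Data.Nat.Divisibility using (_∣_; divides; quotient>1; hasNonTrivialDivisor)
  open import Data.Nat.Primality using (Prime; prime?; ¬prime⇒composite)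
  import Data.Nat.Tactic.RingSolver as ℕSolver
  open import Data.Product using (_×_; _,_; ∃-syntax)
  open import Relation.Nullary using (¬_; yes; no)
  open import Relation.Binary.PropositionalEquality

  composite-split : ∀ {n} → 1 < n → ¬ Prime n → ∃[ a ] ∃[ b ] (1 < a × 1 < b × n ≡ a * b)
  composite-split {n} 1<n ¬prime with ¬prime⇒composite {{ℕ.n>1⇒nonTrivial 1<n}} ¬prime
  ... | hasNonTrivialDivisor {d} {{d-nontrivial}} d<n d∣n@(divides e n≡ed) =
    d , e , ℕ.nonTrivial⇒n>1 d , quotient>1 d∣n d<n , trans n≡ed (*-comm e d)

  data Shape (n : ℕ) : Set where
    prime      : Prime n → Shape n
    semiprime  : ∀ {p q} → Prime p → Prime q → n ≡ p * q → Shape n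
    tripartite : ∀ {a b c} → 1 < a → 1 < b → 1 < c → n ≡ a * (b * c) → Shape n

  shape : ∀ n → 1 < n → Shape n
  shape n 1<n with prime? n
  ... | yes n-prime = prime n-prime
  ... | no ¬prime with composite-split 1<n ¬prime
  ... | a , b , 1<a , 1<b , n≡ab with prime? a | prime? b
  ...   | yes a-prime | yes b-prime = semiprime a-prime b-prime n≡ab
  ...   | _ | no ¬b-prime with composite-split 1<b ¬b-prime
  ...     | c , d , 1<c , 1<d , b≡cd = tripartite 1<a 1<c 1<d (trans n≡ab (cong (a *_) b≡cd))
  shape n 1<n | no _ | a , b , 1<a , 1<b , n≡ab | no ¬a-prime | yes _ with composite-split 1<a ¬a-prime
  ...     | c , d , 1<c , 1<d , a≡cd = tripartite 1<b 1<c 1<d (begin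
    n             ≡⟨ n≡ab ⟩
    a * b         ≡⟨ *-comm a b ⟩
    b * a         ≡⟨ cong (b *_) a≡cd ⟩
    b * (c * d)   ∎)
    where open ≡-Reasoning

  σ₂-equation : ℕ → ℕ → Set
  σ₂-equation l n = σ₂ n + l * l ≡ n * n + l * n + 5

  -- A prime solution p satisfies l² = l p + 4, hence p < l.
  prime-solution-small : ∀ {l p} → Prime p → σ₂-equation l p → p < l
  prime-solution-small {l} {p} p-prime eq = *-cancelˡ-< l p l (subst (l * p <_) (sym l²≡lp+4) (m<m+n (l * p) z<s))
    where
    open ≡-Reasoning
    regroup : ∀ l p → (p * p + 1) + l * l ≡ (1 + p * p) + l * l
    regroup = ℕSolver.solve-∀
    regroup′ : ∀ l p → p * p + l * p + 5 ≡ (p * p + 1) + (l * p + 4)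
    regroup′ = ℕSolver.solve-∀
    l²≡lp+4 : l * l ≡ l * p + 4
    l²≡lp+4 = +-cancelˡ-≡ (p * p + 1) (l * l) (l * p + 4) (begin
      (p * p + 1) + l * l        ≡⟨ regroup l p ⟩
      (1 + p * p) + l * l        ≡⟨ cong (_+ l * l) (σ₂-prime p-prime) ⟨
      σ₂ p + l * l               ≡⟨ eq ⟩
      p * p + l * p + 5          ≡⟨ regroup′ l p ⟩
      (p * p + 1) + (l * p + 4)  ∎)

  -- The square N = p² of a prime is no solution when l ≥ 3 and l² < N: it would
  -- give N + l² = l N + 4, while N + l² < 2N < l N.
  square-solution-impossible : ∀ {l p} → 3 ≤ l → l * l < p * p → Prime p → ¬ σ₂-equation l (p * p)
  square-solution-impossible {l} {p} 3≤l l²<N p-prime eq = <-irrefl N+l²≡lN+4 N+l²<lN+4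
    where
    N = p * p
    regroup : ∀ l N → (N * N + 1) + (N + l * l) ≡ (1 + N + N * N) + l * l
    regroup = ℕSolver.solve-∀
    regroup′ : ∀ l N → N * N + l * N + 5 ≡ (N * N + 1) + (l * N + 4)
    regroup′ = ℕSolver.solve-∀
    N+l²≡lN+4 : N + l * l ≡ l * N + 4
    N+l²≡lN+4 = +-cancelˡ-≡ (N * N + 1) (N + l * l) (l * N + 4) (begin
      (N * N + 1) + (N + l * l)  ≡⟨ regroup l N ⟩
      (1 + N + N * N) + l * l    ≡⟨ cong (_+ l * l) (σ₂-prime-square p-prime) ⟨
      σ₂ N + l * l               ≡⟨ eq ⟩
      N * N + l * N + 5          ≡⟨ regroup′ l N ⟩
      (N * N + 1) + (l * N + 4)  ∎)
      where open ≡-Reasoning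
    N+l²<lN+4 : N + l * l < l * N + 4
    N+l²<lN+4 = begin-strict
      N + l * l                  <⟨ +-monoʳ-< N l²<N ⟩
      N + N                      ≤⟨ m≤m+n (N + N) N ⟩
      N + N + N                  ≡⟨ triple N ⟩
      3 * N                      ≤⟨ *-monoˡ-≤ N 3≤l ⟩
      l * N                      ≤⟨ m≤m+n (l * N) 4 ⟩
      l * N + 4                  ∎
      where
      open ≤-Reasoning
      triple : ∀ N → N + N + N ≡ 3 * N
      triple = ℕSolver.solve-∀

  semiprime-solution : ∀ {l p q} → Prime p → Prime q → p ≢ q → σ₂-equation l (p * q) →
                       p * p + q * q + l * l ≡ l * p * q + 4
  semiprime-solution {l} {p} {q} p-prime q-prime p≢q eq =
    +-cancelˡ-≡ (p * q * (p * q) + 1) (p * p + q * q + l * l) (l * p * q + 4) (begin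
      (p * q * (p * q) + 1) + (p * p + q * q + l * l)   ≡⟨ regroup l p q ⟩
      (1 + p * p + q * q + p * q * (p * q)) + l * l     ≡⟨ cong (_+ l * l) (σ₂-semiprime p-prime q-prime p≢q) ⟨
      σ₂ (p * q) + l * l                                ≡⟨ eq ⟩
      p * q * (p * q) + l * (p * q) + 5                 ≡⟨ regroup′ l p q ⟩
      (p * q * (p * q) + 1) + (l * p * q + 4)           ∎)
    where
    open ≡-Reasoning
    regroup : ∀ l p q → (p * q * (p * q) + 1) + (p * p + q * q + l * l) ≡ (1 + p * p + q * q + p * q * (p * q)) + l * l
    regroup = ℕSolver.solve-∀
    regroup′ : ∀ l p q → p * q * (p * q) + l * (p * q) + 5 ≡ (p * q * (p * q) + 1) + (l * p * q + 4)
    regroup′ = ℕSolver.solve-∀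

  Small-divisors : ℕ → ℕ → Set
  Small-divisors l n = ∀ {d} → d ∣ n → 1 < d → d < n → d * d < l * n

  -- For a solution with l² ≥ 5, every proper divisor d satisfies d² < l n, since
  -- σ₂ n ≥ 1 + d² + n².
  proper-divisor-bound : ∀ {l n} → 5 ≤ l * l → σ₂-equation l n → Small-divisors l n
  proper-divisor-bound {l} {n} 5≤l² eq {d} d∣n 1<d d<n =
    +-cancelˡ-≤ (n * n + 5) (suc (d * d)) (l * n) (begin
      n * n + 5 + suc (d * d)          ≡⟨ regroup d n ⟩
      1 + d * d + n * n + 5            ≤⟨ +-monoʳ-≤ (1 + d * d + n * n) 5≤l² ⟩
      1 + d * d + n * n + l * l        ≤⟨ +-monoˡ-≤ (l * l) (σ₂-proper-divisor d∣n 1<d d<n) ⟩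
      σ₂ n + l * l                     ≡⟨ eq ⟩
      n * n + l * n + 5                ≡⟨ regroup′ l n ⟩
      n * n + 5 + l * n                ∎)
    where
    open ≤-Reasoning
    regroup : ∀ d n → n * n + 5 + suc (d * d) ≡ 1 + d * d + n * n + 5
    regroup = ℕSolver.solve-∀
    regroup′ : ∀ l n → n * n + l * n + 5 ≡ n * n + 5 + l * n
    regroup′ = ℕSolver.solve-∀

  cofactor-bound : ∀ {l n x y} → Small-divisors l n →
                   n ≡ x * y → 1 < x → 1 < y → y < l * x
  cofactor-bound {l} {n} {x} {y} small n≡xy 1<x 1<y =
    *-cancelʳ-< y y (l * x) (subst (y * y <_) ln≡lxy (small (divides x n≡xy) 1<y y<n))
    where
    y<n : y < n
    y<n = subst (y <_) (trans (*-comm y x) (sym n≡xy)) (m<m*n y x {{ℕ.>-nonZero (<-trans z<s 1<y)}} 1<x)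
    ln≡lxy : l * n ≡ l * x * y
    ln≡lxy = trans (cong (l *_) n≡xy) (sym (*-assoc l x y))

  -- ... and consequently n cannot have three factors > 1 unless n < l³:
  -- multiplying bc < l a, ac < l b and ab < l c gives n² < l³ n.
  tripartite-bound : ∀ {l n a b c} → Small-divisors l n →
                     1 < a → 1 < b → 1 < c → n ≡ a * (b * c) → n < l * l * l
  tripartite-bound {l} {n} {a} {b} {c} small 1<a 1<b 1<c n≡abc = *-cancelʳ-< n n (l * l * l) (begin-strict
      n * n                                 ≡⟨ cong₂ _*_ n≡abc n≡abc ⟩
      (a * (b * c)) * (a * (b * c))         ≡⟨ regroup a b c ⟩
      (b * c) * (a * c) * (a * b)           <⟨ *-mono-< (*-mono-< bc<la ac<lb) ab<lc ⟩
      (l * a) * (l * b) * (l * c)           ≡⟨ regroup′ l a b c ⟩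
      l * l * l * (a * (b * c))             ≡⟨ cong (l * l * l *_) n≡abc ⟨
      l * l * l * n                         ∎)
    where
    open ≤-Reasoning
    product>1 : ∀ {x y} → 1 < x → 1 < y → 1 < x * y
    product>1 {x} {y} 1<x 1<y = <-≤-trans 1<x (m≤m*n x y {{ℕ.>-nonZero (<-trans z<s 1<y)}})
    bc<la : b * c < l * a
    bc<la = cofactor-bound {l} small n≡abc 1<a (product>1 1<b 1<c)
    ac<lb : a * c < l * b
    ac<lb = cofactor-bound {l} small (trans n≡abc (rotate a b c)) 1<b (product>1 1<a 1<c)
      where
      rotate : ∀ a b c → a * (b * c) ≡ b * (a * c)
      rotate = ℕSolver.solve-∀
    ab<lc : a * b < l * c
    ab<lc = cofactor-bound {l} small (trans n≡abc (rotate a b c)) 1<c (product>1 1<a 1<b)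
      where
      rotate : ∀ a b c → a * (b * c) ≡ c * (a * b)
      rotate = ℕSolver.solve-∀
    regroup : ∀ a b c → (a * (b * c)) * (a * (b * c)) ≡ (b * c) * (a * c) * (a * b)
    regroup = ℕSolver.solve-∀
    regroup′ : ∀ l a b c → (l * a) * (l * b) * (l * c) ≡ l * l * l * (a * (b * c))
    regroup′ = ℕSolver.solve-∀

module Reduction where

  open LucasEquation
  open DivisorSums
  open SolutionShapes
  open import Data.Nat using (ℕ; zero; suc; _+_; _*_; _^_; _∸_; _≤_; _<_)
  open import Data.Nat.Properties
  open import Data.Nat.Primality using (Prime)
  import Data.Nat.Tactic.RingSolver as ℕSolver
  import Data.Integer as ℤ
  open ℤ using (ℤ; +_)
  import Data.Integer.Properties as ℤP
  open import Data.Integer.Tactic.RingSolver using (solve-∀)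
  open import Data.Product using (_×_; _,_; ∃-syntax)
  open import Data.Sum using (_⊎_; inj₁; inj₂)
  open import Relation.Binary.PropositionalEquality

  L≥3 : ∀ n → 3 ≤ L (2 + n)
  L≥3 zero = ≤-refl
  L≥3 (suc n) = ≤-trans (L≥3 n) (m≤m+n (L (2 + n)) (L (1 + n)))

  L-even≥3 : ∀ m → 1 ≤ m → 3 ≤ L (2 * m)
  L-even≥3 (suc m) _ = subst (λ i → 3 ≤ L i) (sym (cong suc (+-suc m (m + 0)))) (L≥3 (2 * m))

  square-as-product : ∀ x → x ^ 2 ≡ x * x
  square-as-product x = cong (x *_) (*-identityʳ x)

  σ₂-equation-from-ℤ : ∀ {l n} → (+ σ₂ n) ℤ.- (+ (n ^ 2)) ≡ (+ (l * n)) ℤ.- ((+ (l ^ 2)) ℤ.- (+ 5)) →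
                       σ₂-equation l n
  σ₂-equation-from-ℤ {l} {n} eq = ℤP.+-injective (begin
      + (σ₂ n + l * l)                                  ≡⟨ ℤP.pos-+ (σ₂ n) (l * l) ⟩
      + σ₂ n ℤ.+ + (l * l)                               ≡⟨ rearrange (+ σ₂ n) (+ (n * n)) (+ (l * l)) ⟩
      (+ σ₂ n ℤ.- + (n * n)) ℤ.+ (+ (n * n) ℤ.+ + (l * l)) ≡⟨ cong₂ (λ a b → (+ σ₂ n ℤ.- + a) ℤ.+ (+ (n * n) ℤ.+ + b))
                                                               (square-as-product n) (square-as-product l) ⟨
      (+ σ₂ n ℤ.- + (n ^ 2)) ℤ.+ (+ (n * n) ℤ.+ + (l ^ 2)) ≡⟨ cong (ℤ._+ (+ (n * n) ℤ.+ + (l ^ 2))) eq ⟩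
      (+ (l * n) ℤ.- (+ (l ^ 2) ℤ.- + 5)) ℤ.+ (+ (n * n) ℤ.+ + (l ^ 2))
                                                         ≡⟨ rearrange′ (+ (l * n)) (+ (n * n)) (+ (l ^ 2)) ⟩
      (+ (n * n) ℤ.+ + (l * n)) ℤ.+ + 5                  ≡⟨ cong (ℤ._+ + 5) (ℤP.pos-+ (n * n) (l * n)) ⟨
      + (n * n + l * n) ℤ.+ + 5                          ≡⟨ ℤP.pos-+ (n * n + l * n) 5 ⟨
      + (n * n + l * n + 5)                              ∎)
    where
    open ≡-Reasoning
    rearrange : ∀ s a c → s ℤ.+ c ≡ (s ℤ.- a) ℤ.+ (a ℤ.+ c)
    rearrange = solve-∀
    rearrange′ : ∀ b a c → (b ℤ.- (c ℤ.- + 5)) ℤ.+ (a ℤ.+ c) ≡ (a ℤ.+ b) ℤ.+ + 5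
    rearrange′ = solve-∀

  pos-^ : ∀ a k → (+ a) ℤ.^ k ≡ + (a ^ k)
  pos-^ a zero = refl
  pos-^ a (suc k) = trans (cong ((+ a) ℤ.*_) (pos-^ a k)) (sym (ℤP.pos-* a (a ^ k)))

  size-base : ∀ {l} → 5 ≤ l * l → ((+ l) ℤ.+ (+ (l ^ 2))) ℤ.- (+ 5) ≡ + (l + (l * l ∸ 5))
  size-base {l} 5≤l² = begin
      (+ l ℤ.+ + (l ^ 2)) ℤ.- + 5          ≡⟨ cong (λ t → (+ l ℤ.+ + t) ℤ.- + 5)
                                                   (trans (square-as-product l) (sym (m∸n+n≡m 5≤l²))) ⟩
      (+ l ℤ.+ + (r + 5)) ℤ.- + 5          ≡⟨ cong (λ t → (+ l ℤ.+ t) ℤ.- + 5) (ℤP.pos-+ r 5) ⟩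
      (+ l ℤ.+ (+ r ℤ.+ + 5)) ℤ.- + 5      ≡⟨ cancel (+ l) (+ r) ⟩
      + l ℤ.+ + r                         ≡⟨ ℤP.pos-+ l r ⟨
      + (l + r)                           ∎
    where
    open ≡-Reasoning
    r = l * l ∸ 5
    cancel : ∀ a r → (a ℤ.+ (r ℤ.+ + 5)) ℤ.- + 5 ≡ a ℤ.+ r
    cancel = solve-∀

  cube-bound : ∀ {l n} → 5 ≤ l * l → (((+ l) ℤ.+ (+ (l ^ 2))) ℤ.- (+ 5)) ℤ.^ 3 ℤ.< (+ n) → l * l * l < n
  cube-bound {l} {n} 5≤l² size = begin-strict
      l * l * l                    ≡⟨ cube l ⟩
      l ^ 3                        ≤⟨ ^-monoˡ-≤ 3 (m≤m+n l (l * l ∸ 5)) ⟩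
      (l + (l * l ∸ 5)) ^ 3        <⟨ ℤP.drop‿+<+ (subst (ℤ._< + n) base³ size) ⟩
      n                            ∎
    where
    open ≤-Reasoning
    cube : ∀ l → l * l * l ≡ l * (l * (l * 1))
    cube = ℕSolver.solve-∀
    base³ : (((+ l) ℤ.+ (+ (l ^ 2))) ℤ.- (+ 5)) ℤ.^ 3 ≡ + ((l + (l * l ∸ 5)) ^ 3)
    base³ = trans (cong (ℤ._^ 3) (size-base {l} 5≤l²)) (pos-^ (l + (l * l ∸ 5)) 3)

  Lucas-product-form : ℕ → ℕ → Set
  Lucas-product-form m n =
      (∃[ k ] (n ≡ L (2 * k) * L (2 * k + 2 * m)
                × Prime (L (2 * k)) × Prime (L (2 * k + 2 * m))))
      ⊎
      (∃[ k ] (k ≤ m × 2 * k ≢ m × n ≡ L (2 * k) * L (2 * m ∸ 2 * k)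
                × Prime (L (2 * k)) × Prime (L (2 * m ∸ 2 * k))))

  -- A product of distinct primes p, q forming a Lucas pair has one of the two
  -- forms; in the second form 2k ≠ m, since otherwise p = q.
  semiprime-form : ∀ {m p q} → Prime p → Prime q → p ≢ q → Lucas-pair m p q → Lucas-product-form m (p * q)
  semiprime-form p-prime q-prime p≢q (inj₁ (k , p≡ , q≡)) =
    inj₁ (k , cong₂ _*_ p≡ q≡ , subst Prime p≡ p-prime , subst Prime q≡ q-prime)
  semiprime-form {p = p} {q} p-prime q-prime p≢q (inj₂ (inj₁ (k , q≡ , p≡))) =
    inj₁ (k , trans (*-comm p q) (cong₂ _*_ q≡ p≡) , subst Prime q≡ q-prime , subst Prime p≡ p-prime)
  semiprime-form {m} p-prime q-prime p≢q (inj₂ (inj₂ (k , k≤m , p≡ , q≡))) =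
    inj₂ (k , k≤m , 2k≢m , cong₂ _*_ p≡ q≡ , subst Prime p≡ p-prime , subst Prime q≡ q-prime)
    where
    2k≢m : 2 * k ≢ m
    2k≢m 2k≡m = p≢q (trans p≡ (trans (cong L (sym index)) (sym q≡)))
      where
      index : 2 * m ∸ 2 * k ≡ 2 * k
      index = trans (cong (λ t → 2 * t ∸ 2 * k) (sym 2k≡m))
                    (trans (m+n∸m≡n (2 * k) (2 * k + 0)) (+-identityʳ (2 * k)))

open import Data.Nat using (ℕ; _≤_; _^_; _*_; _+_; _∸_; _<_; _≟_; s≤s; z≤n; z<s; >-nonZero)
open import Data.Nat.Properties using (≤-trans; ≤-<-trans; <-≤-trans; <⇒≤; <⇒≯; *-mono-≤; m≤m*n)
open import Data.Nat.Primality using (Prime)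
import Data.Integer as ℤ
open ℤ using (ℤ; +_)
open import Data.Product using (∃-syntax; _×_)
open import Data.Sum using (_⊎_)
open import Relation.Nullary using (yes; no; contradiction)
open import Relation.Binary.PropositionalEquality using (_≡_; _≢_; refl)
open LucasEquation using (lucas-equation-solutions)
open DivisorSums using (prime>1)
open SolutionShapes
open Reduction

theorem1p5 : (m n : ℕ) → 1 ≤ m → 1 ≤ n →
    (+ σ₂ n) ℤ.- (+ (n ^ 2))
      ≡ (+ (L (2 * m) * n)) ℤ.- ((+ (L (2 * m) ^ 2)) ℤ.- (+ 5)) →
    (((+ L (2 * m)) ℤ.+ (+ (L (2 * m) ^ 2))) ℤ.- (+ 5)) ℤ.^ 3 ℤ.< (+ n) →
    (∃[ k ] (n ≡ L (2 * k) * L (2 * k + 2 * m)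
              × Prime (L (2 * k)) × Prime (L (2 * k + 2 * m))))
    ⊎
    (∃[ k ] (k ≤ m × 2 * k ≢ m × n ≡ L (2 * k) * L (2 * m ∸ 2 * k)
              × Prime (L (2 * k)) × Prime (L (2 * m ∸ 2 * k))))
theorem1p5 m n 1≤m _ integer-equation size = by-shape (shape n 1<n)
  where
  l = L (2 * m)
  3≤l : 3 ≤ l
  3≤l = L-even≥3 m 1≤m
  5≤l² : 5 ≤ l * l
  5≤l² = ≤-trans (s≤s (s≤s (s≤s (s≤s (s≤s z≤n))))) (*-mono-≤ 3≤l 3≤l)
  eq : σ₂-equation l n
  eq = σ₂-equation-from-ℤ {l} integer-equation
  l³<n : l * l * l < n
  l³<n = cube-bound {l} 5≤l² size
  l²<n : l * l < n
  l²<n = ≤-<-trans (m≤m*n (l * l) l {{>-nonZero (<-≤-trans z<s 3≤l)}}) l³<n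
  l<n : l < n
  l<n = ≤-<-trans (m≤m*n l l {{>-nonZero (<-≤-trans z<s 3≤l)}}) l²<n
  1<n : 1 < n
  1<n = <-≤-trans (s≤s (s≤s z≤n)) (≤-trans 3≤l (<⇒≤ l<n))
  by-shape : Shape n → Lucas-product-form m n
  by-shape (prime n-prime) = contradiction (prime-solution-small {l} n-prime eq) (<⇒≯ l<n)
  by-shape (tripartite 1<a 1<b 1<c n≡abc) =
    contradiction (tripartite-bound {l} (proper-divisor-bound {l} 5≤l² eq) 1<a 1<b 1<c n≡abc) (<⇒≯ l³<n)
  by-shape (semiprime {p} {q} p-prime q-prime refl) with p ≟ q
  ... | yes refl = contradiction eq (square-solution-impossible {l} 3≤l l²<n p-prime)
  ... | no p≢q = semiprime-form p-prime q-prime p≢q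
                   (lucas-equation-solutions m p q 1≤m (prime>1 p-prime)
                      (semiprime-solution {l} p-prime q-prime p≢q eq))
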